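{- Let $(T,\mathcal{X})$ be a nice tree-cut decomposition of width $k$ of a capacitated graph $G$, and let $t$ be any node of $T$. Then $\beta_t(H)\in\{0,1,\dots,k\}\cup\{\infty\}$ for every $H\in\mathcal{Q}_t$.
   Context: A capacitated graph is a finite simple graph $G=(V,E)$ with a capacity function $c:V\rightarrow\mathbb{N}_0$. A set $C\subseteq V$ is a capacitated vertex cover of $G$ if there is a mapping $f:E\rightarrow C$ sending every edge to one of its endpoints such that for every $v\in C$ at most $c(v)$ edges are mapped to $v$. For a graph $H$ with capacities and $U\subseteq V(H)$, $\mathsf{cvc}(H,U)$ is the minimum cardinality of a capacitated vertex cover $C\subseteq U$ of $H$, or $\infty$ if none exists. For $Y\subseteq V$, $N(Y)$ is the set of vertices outside $Y$ adjacent to a vertex of $Y$. A tree-cut decomposition of $G$ is a pair $(T,\mathcal{X})$ where $T$ is a tree and $\mathcal{X}=\{X_t : t\in V(T)\}$ is a family of pairwise disjoint, possibly empty, subsets of $V(G)$ whose union is $V(G)$. For an edge $e=uv$ of $T$, $\mathsf{cut}(e)$ is the set of edges of $G$ with one endpoint in the union of bags of the component of $T-e$ containing $u$ and the other in the union of bags of the component containing $v$. The torso $H_t$ at a node $t$: if $T$ has a single node, $H_t=G$; otherwise for the components $T_1,\dots,T_\ell$ of $T-t$ with $Z_i=\bigcup_{b\in V(T_i)}X_b$, $H_t$ is the multigraph obtained from $G$ by replacing each $Z_i$ by a single new vertex $z_i$ and, for each edge of $G$ between $Z_i$ and a vertex $v\notin Z_i$, adding an edge $z_iv$. Suppressing a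 vertex $v$ of degree at most $2$ means deleting $v$ and, if its degree is $2$, adding an edge between its two neighbours (loops contribute $2$ to the degree). The 3-center of $(H,X)$ is obtained from $H$ by exhaustively suppressing vertices of $V(H)\setminus X$ of degree at most two. $\mathsf{tor}(t)$ is the number of vertices of the 3-center of $(H_t,X_t)$. The width is the maximum of $\max_{e\in E(T)}|\mathsf{cut}(e)|$ and $\max_{t}\mathsf{tor}(t)$. In a rooted decomposition with root $r$: for $t\neq r$, $\mathsf{adh}(t)$ is $|\mathsf{cut}(e)|$ for the edge $e$ from $t$ to its parent, $\mathsf{adh}(r)=0$; $Y_t$ is the union of bags of the subtree rooted at $t$. A node $t\neq r$ is thin if $\mathsf{adh}(t)\le 2$; the decomposition is nice if for every thin node $t$, $N(Y_t)$ is disjoint from $Y_b$ for every sibling $b$ of $t$. For a node $t$: $a_t=\mathsf{cvc}(G[Y_t],Y_t)$; $E_t$ is the set of edges with both endpoints in $Y_t$ and $K_t$ the set of edges with exactly one endpoint in $Y_t$; $\mathcal{Q}_t=\{H=(Y_t\cup N(Y_t),E_t\cup E') : E'\subseteq K_t\}$ with vertices keeping their capacities; $\beta_t(H)=\mathsf{cvc}(H,Y_t)-a_t$, where $\infty-x=\infty$ for every $x$, including $\infty-\infty=\infty$. -}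

module Defs where

open import Data.Bool using (Bool; true; false; _∨_; _∧_; not; if_then_else_; T)
open import Data.Nat using (ℕ; zero; suc; _+_; _∸_; _≤_)
open import Data.Integer using (ℤ) renaming (_-_ to _-ℤ_; +_ to ℤ+)
open import Data.Fin using (Fin; _<?_)
open import Data.Fin.Properties using () renaming (_≟_ to _≟F_)
open import Data.Fin.Subset using (Subset; _∈_; _∉_; _⊆_; ∣_∣)
open import Data.List using (List; []; _∷_; _++_; map; filterᵇ; length; cartesianProduct; concatMap)
open import Data.Nat.ListAction using (sum)
open import Data.List.Membership.Propositional using () renaming (_∈_ to _∈L_)
open import Data.List.Relation.Unary.All using (All)
open import Data.Maybe using (Maybe; just; nothing)
import Data.Maybe.Properties as MP
import Data.Sum.Properties as SP
open import Data.Sum using (_⊎_; inj₁; inj₂)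
open import Data.Product using (Σ; ∃; _×_; _,_; proj₁; proj₂)
open import Data.Vec using (tabulate)
open import Data.Vec.Functional using ()
open import Data.Fin using (toℕ)
open import Data.List using () renaming (allFin to allFinL)
open import Relation.Nullary using (¬_; Dec; yes; no; ⌊_⌋)
open import Relation.Binary.PropositionalEquality using (_≡_; _≢_)
open import Relation.Binary.Definitions using (DecidableEquality)

record CGraph : Set where
  field
    n   : ℕ
    adj : Fin n → Fin n → Bool
    adj-sym : ∀ u v → adj u v ≡ adj v u
    adj-irr : ∀ v → adj v v ≡ false
    cap : Fin n → ℕ

open CGraph public

-- an edge {u,v} is represented by the pair (u , v) with u < v
Edge : CGraph → Set
Edge G = Fin (n G) × Fin (n G)

edges : (G : CGraph) → List (Edge G)
edges G = filterᵇ (λ e → ⌊ proj₁ e <? proj₂ e ⌋ ∧ adj G (proj₁ e) (proj₂ e))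
                  (cartesianProduct (allFinL (n G)) (allFinL (n G)))

-- Capacitated vertex covers.
-- A (sub)graph H of G is given by a selection  sel  of edges of G;
-- its edge set is  edgesOf G sel.

edgesOf : (G : CGraph) → (Edge G → Bool) → List (Edge G)
edgesOf G sel = filterᵇ sel (edges G)

load : (G : CGraph) → List (Edge G) → (Edge G → Fin (n G)) → Fin (n G) → ℕ
load G es f v = length (filterᵇ (λ e → ⌊ f e ≟F v ⌋) es)

IsCVC : (G : CGraph) → (Edge G → Bool) → Subset (n G) → Subset (n G) → Set
IsCVC G sel U C =
  C ⊆ U ×
  Σ (Edge G → Fin (n G)) λ f →
    All (λ e → (f e ≡ proj₁ e ⊎ f e ≡ proj₂ e) × f e ∈ C) (edgesOf G sel) ×
    (∀ v → v ∈ C → load G (edgesOf G sel) f v ≤ cap G v)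

data ℕ∞ : Set where
  fin : ℕ → ℕ∞
  ∞   : ℕ∞

CvcIs : (G : CGraph) → (Edge G → Bool) → Subset (n G) → ℕ∞ → Set
CvcIs G sel U (fin m) =
  (Σ (Subset (n G)) λ C → IsCVC G sel U C × ∣ C ∣ ≡ m) ×
  (∀ C → IsCVC G sel U C → m ≤ ∣ C ∣)
CvcIs G sel U ∞ = ∀ C → ¬ IsCVC G sel U C

data ℤ∞ : Set where
  int       : ℤ → ℤ∞
  ∞         : ℤ∞
  undefined : ℤ∞

_−∞_ : ℕ∞ → ℕ∞ → ℤ∞
∞ −∞ _ = ∞
fin x −∞ fin y = int (ℤ+ x -ℤ ℤ+ y)
fin x −∞ ∞ = undefined

-- The tree T has nodes Fin m, root  root, parent function  par  and a depth
-- function certifying that iterating par from any node reaches the root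
-- (so T is a rooted tree; every rooted tree arises this way).
-- bag v is the node whose bag X_t contains v (bags are disjoint, may be
-- empty, and cover V(G)).

record RTCD (G : CGraph) : Set where
  field
    m     : ℕ
    root  : Fin m
    par   : Fin m → Fin m
    depth : Fin m → ℕ
    depth-root : depth root ≡ 0
    depth-par  : ∀ t → t ≢ root → depth t ≡ suc (depth (par t))
    bag   : Fin (n G) → Fin m

open RTCD public

module _ {G : CGraph} (D : RTCD G) where

  isAnc : ℕ → Fin (m D) → Fin (m D) → Bool
  isAnc zero    t u = ⌊ t ≟F u ⌋
  isAnc (suc d) t u = ⌊ t ≟F u ⌋ ∨ isAnc d t (par D u)

  inSub : Fin (m D) → Fin (m D) → Bool
  inSub t u = isAnc (depth D u) t u

  inY : Fin (m D) → Fin (n G) → Bool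
  inY t v = inSub t (bag D v)

  Y : Fin (m D) → Subset (n G)
  Y t = tabulate (inY t)

  cutSize : Fin (m D) → ℕ
  cutSize t = length (filterᵇ (λ e → not (inY t (proj₁ e) ∧ inY t (proj₂ e))
                                      ∧ (inY t (proj₁ e) ∨ inY t (proj₂ e)))
                              (edges G))

  adh : Fin (m D) → ℕ
  adh t with t ≟F root D
  ... | yes _ = 0
  ... | no  _ = cutSize t

  InN : Fin (m D) → Fin (n G) → Set
  InN t v = inY t v ≡ false × ∃ λ u → inY t u ≡ true × adj G u v ≡ true

  Sibling : Fin (m D) → Fin (m D) → Set
  Sibling t b = b ≢ t × b ≢ root D × par D b ≡ par D t

  Nice : Set
  Nice = ∀ t → t ≢ root D → adh t ≤ 2 →
         ∀ b → Sibling t b → ∀ v → InN t v → inY b v ≡ false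

  inE : Fin (m D) → Edge G → Bool
  inE t e = inY t (proj₁ e) ∧ inY t (proj₂ e)

  inK : Fin (m D) → Edge G → Bool
  inK t e = not (inE t e) ∧ (inY t (proj₁ e) ∨ inY t (proj₂ e))

record MG (V : Set) : Set where
  constructor mg
  field
    verts : List V
    medges : List (V × V)

open MG public

module Suppress {V : Set} (_≟_ : DecidableEquality V) (X : V → Bool) where

  ends : V → V × V → ℕ
  ends v (a , b) = (if ⌊ a ≟ v ⌋ then 1 else 0) + (if ⌊ b ≟ v ⌋ then 1 else 0)

  -- degree; a loop contributes 2
  deg : MG V → V → ℕ
  deg H v = sum (map (ends v) (medges H))

  incident : V → V × V → Bool
  incident v (a , b) = ⌊ a ≟ v ⌋ ∨ ⌊ b ≟ v ⌋

  otherEnd : V → V × V → List V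
  otherEnd v (a , b) with a ≟ v | b ≟ v
  ... | yes _ | yes _ = []
  ... | yes _ | no  _ = b ∷ []
  ... | no  _ | yes _ = a ∷ []
  ... | no  _ | no  _ = []

  nbrs : MG V → V → List V
  nbrs H v = concatMap (otherEnd v) (medges H)

  suppress : MG V → V → MG V
  suppress H v = mg (filterᵇ (λ w → not ⌊ w ≟ v ⌋) (verts H))
                    (newEdge (nbrs H v) ++ filterᵇ (λ e → not (incident v e)) (medges H))
    where
    newEdge : List V → List (V × V)
    newEdge (a ∷ b ∷ []) = (a , b) ∷ []
    newEdge _ = []

  Suppressible : MG V → V → Set
  Suppressible H v = v ∈L verts H × X v ≡ false × deg H v ≤ 2

  data Steps : MG V → MG V → Set where
    done : ∀ {H} → Steps H H
    step : ∀ {H H'} v → Suppressible H v → Steps (suppress H v) H' → Steps H H'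

  Final : MG V → Set
  Final H = ∀ v → ¬ Suppressible H v

  ThreeCenter : MG V → MG V → Set
  ThreeCenter H H' = Steps H H' × Final H'

module _ {G : CGraph} (D : RTCD G) where

  -- vertices of torsos: original vertices (inj₁ v, v ∈ X_t) and contracted
  -- components of T − t: inj₂ (just c) for the subtree of a child c of t,
  -- inj₂ nothing for the component containing the parent of t
  TV : Set
  TV = Fin (n G) ⊎ Maybe (Fin (m D))

  _≟TV_ : DecidableEquality TV
  _≟TV_ = SP.≡-dec _≟F_ (MP.≡-dec _≟F_)

  inX : TV → Bool
  inX (inj₁ _) = true
  inX (inj₂ _) = false

  climb : ℕ → Fin (m D) → Fin (m D)
  climb zero    u = u
  climb (suc k) u = climb k (par D u)

  rep : Fin (m D) → Fin (n G) → TV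
  rep t v with bag D v ≟F t
  ... | yes _ = inj₁ v
  ... | no  _ = if inY D t v
                  then inj₂ (just (climb (depth D (bag D v) ∸ suc (depth D t)) (bag D v)))
                  else inj₂ nothing

  isChild : Fin (m D) → Fin (m D) → Bool
  isChild t c = not ⌊ c ≟F root D ⌋ ∧ ⌊ par D c ≟F t ⌋

  torso : Fin (m D) → MG TV
  torso t = mg
    (map inj₁ (filterᵇ (λ v → ⌊ bag D v ≟F t ⌋) (allFinL (n G)))
     ++ map (λ c → inj₂ (just c)) (filterᵇ (isChild t) (allFinL (m D)))
     ++ (if ⌊ t ≟F root D ⌋ then [] else inj₂ nothing ∷ []))
    (filterᵇ (λ e → not ⌊ proj₁ e ≟TV proj₂ e ⌋)
             (map (λ e → rep t (proj₁ e) , rep t (proj₂ e)) (edges G)))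

  TorAtMost : Fin (m D) → ℕ → Set
  TorAtMost t k = ∀ H' → Suppress.ThreeCenter _≟TV_ inX (torso t) H' → length (verts H') ≤ k

  WidthAtMost : ℕ → Set
  WidthAtMost k = (∀ t → t ≢ root D → cutSize D t ≤ k) × (∀ t → TorAtMost t k)

InRangeβ : ℕ → ℤ∞ → Set
InRangeβ k b = (Σ ℕ λ j → j ≤ k × b ≡ int (ℤ+ j)) ⊎ b ≡ ∞

-- A cover of H restricts to one of G[Y_t], so β_t(H) is ∞ or nonnegative.  For the upper
-- bound, adding one edge e raises the capacitated cover number within U by at most one,
-- provided the larger graph has some cover C' ⊆ U: given an optimal assignment for the
-- smaller graph with cover C, send e to the end w that C' uses, and while w carries more
-- than c(w) edges pick one of them that C' sends to its other end (one exists because C'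
-- respects c(w)), move it there and let that end be the new w.  Every move makes the
-- assignment agree with C' on one more edge, and when it stops C ∪ {w} is a cover.  Hence
-- β_t(H) ≤ |E'| ≤ |K_t|, which is adh(t) ≤ k, or 0 at the root.

module Submission where

open import Data.Bool using (Bool; true; false; _∨_; _∧_; not; if_then_else_)
open import Data.Bool.Properties using (∨-identityʳ; ∨-zeroʳ; T-≡)
open import Data.Fin using (Fin)
open import Data.Fin.Properties using (_≟_)
open import Data.Fin.Subset using (Subset; _∈_; _∉_; _⊆_; ∣_∣; _∪_; ⁅_⁆; inside; outside)
open import Data.Fin.Subset.Properties
  using (_∈?_; x∈p∪q⁻; x∈p∪q⁺; p⊆p∪q; x∈⁅x⁆; x∈⁅y⁆⇒x≡y; ∣⁅x⁆∣≡1)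
import Data.Integer.Properties as ℤ
open import Data.List using (List; []; _∷_; filterᵇ; length)
open import Data.List.Membership.Propositional using () renaming (_∈_ to _∈ˡ_)
open import Data.List.Membership.Propositional.Properties using (∈-filter⁺; ∈-filter⁻)
open import Data.List.Relation.Unary.All using (All)
import Data.List.Relation.Unary.All as All
open import Data.List.Relation.Unary.AllPairs using (_∷_)
open import Data.List.Relation.Unary.Any using (here; there)
open import Data.List.Relation.Unary.Unique.Propositional using (Unique)
import Data.List.Relation.Unary.Unique.Propositional.Properties as Unique
open import Data.Nat using (ℕ; zero; suc; _+_; _∸_; _≤_; _<_; z≤n; s≤s; _≤?_)
open import Data.Nat.Induction using (<-wellFounded)
open import Data.Nat.Properties
  using (≤-refl; ≤-reflexive; ≤-trans; ≤-<-trans; ≤-pred; n≤1+n; m≤m+n; m≤n+m; n≮n; ≰⇒>;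
         +-comm; +-assoc; +-identityʳ; +-suc; +-mono-≤; +-monoˡ-≤; +-monoʳ-≤; +-cancelʳ-≤;
         suc-injective; 1+n≢0; m≤n+o⇒m∸n≤o; +-commutativeSemigroup; module ≤-Reasoning)
open import Algebra.Properties.CommutativeSemigroup +-commutativeSemigroup using (xy∙z≈zy∙x)
open import Data.Product using (∃; _×_; _,_; proj₁; proj₂; map₁; map₂)
open import Data.Product.Properties using (≡-dec)
open import Data.Sum using (_⊎_; inj₁; inj₂)
open import Data.Vec using ([]; _∷_)
open import Function using (_∘_; Equivalence)
open import Induction.WellFounded using (Acc; acc)
open import Relation.Binary.Definitions using (DecidableEquality)
open import Relation.Binary.PropositionalEquality
open import Relation.Nullary using (yes; no; ⌊_⌋; contradiction)
open import Relation.Nullary.Decidable using (T?)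
open import Defs

𝟙[_] : Bool → ℕ
𝟙[ true  ] = 1
𝟙[ false ] = 0

module _ {A : Set} (_≟ᴬ_ : DecidableEquality A) where

  ≟-refl : ∀ x → ⌊ x ≟ᴬ x ⌋ ≡ true
  ≟-refl x with x ≟ᴬ x
  ... | yes _ = refl
  ... | no x≢x = contradiction refl x≢x

  ≢⇒≟-false : ∀ {x y} → x ≢ y → ⌊ x ≟ᴬ y ⌋ ≡ false
  ≢⇒≟-false {x} {y} x≢y with x ≟ᴬ y
  ... | yes x≡y = contradiction x≡y x≢y
  ... | no _ = refl

  ≟-true⇒≡ : ∀ {x y} → ⌊ x ≟ᴬ y ⌋ ≡ true → x ≡ y
  ≟-true⇒≡ {x} {y} eq with x ≟ᴬ y
  ... | yes x≡y = x≡y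

  ≟-false⇒≢ : ∀ {x y} → ⌊ x ≟ᴬ y ⌋ ≡ false → x ≢ y
  ≟-false⇒≢ {x} eq refl with trans (sym (≟-refl x)) eq
  ... | ()

module _ {A : Set} where

  count : (A → Bool) → List A → ℕ
  count P xs = length (filterᵇ P xs)

  count-∷ : ∀ P x xs → count P (x ∷ xs) ≡ 𝟙[ P x ] + count P xs
  count-∷ P x xs with P x
  ... | true  = refl
  ... | false = refl

  count-cong : ∀ P Q xs → (∀ x → x ∈ˡ xs → P x ≡ Q x) → count P xs ≡ count Q xs
  count-cong P Q [] _ = refl
  count-cong P Q (x ∷ xs) P≗Q
    rewrite count-∷ P x xs | count-∷ Q x xs | P≗Q x (here refl)
          | count-cong P Q xs (λ y → P≗Q y ∘ there) = refl

  count-mono : ∀ P Q xs → (∀ x → x ∈ˡ xs → P x ≡ true → Q x ≡ true) → count P xs ≤ count Q xs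
  count-mono P Q [] _ = z≤n
  count-mono P Q (x ∷ xs) P⇒Q
    rewrite count-∷ P x xs | count-∷ Q x xs =
      +-mono-≤ (head-mono (P x) (Q x) (P⇒Q x (here refl))) (count-mono P Q xs (λ y → P⇒Q y ∘ there))
    where
    head-mono : ∀ a b → (a ≡ true → b ≡ true) → 𝟙[ a ] ≤ 𝟙[ b ]
    head-mono false _     _   = z≤n
    head-mono true  true  _   = ≤-refl
    head-mono true  false a⇒b with a⇒b refl
    ... | ()

  count-none : ∀ P xs → (∀ x → x ∈ˡ xs → P x ≡ false) → count P xs ≡ 0
  count-none P [] _ = refl
  count-none P (x ∷ xs) P≡false
    rewrite count-∷ P x xs | P≡false x (here refl) = count-none P xs (λ y → P≡false y ∘ there)

  count-∈ : ∀ P {x xs} → x ∈ˡ xs → P x ≡ true → 0 < count P xs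
  count-∈ P {xs = y ∷ ys} (here refl) Px rewrite count-∷ P y ys | Px = s≤s z≤n
  count-∈ P {xs = y ∷ ys} (there x∈) Px
    rewrite count-∷ P y ys = ≤-trans (count-∈ P x∈ Px) (m≤n+m _ 𝟙[ P y ])

  count-<⇒∃ : ∀ P Q xs → count Q xs < count P xs →
              ∃ λ x → x ∈ˡ xs × P x ≡ true × Q x ≡ false
  count-<⇒∃ P Q (x ∷ xs) lt
    rewrite count-∷ P x xs | count-∷ Q x xs with P x in Px | Q x in Qx
  ... | true  | false = x , here refl , Px , Qx
  ... | true  | true  = map₂ (map₁ there) (count-<⇒∃ P Q xs (≤-pred lt))
  ... | false | false = map₂ (map₁ there) (count-<⇒∃ P Q xs lt)
  ... | false | true  = map₂ (map₁ there) (count-<⇒∃ P Q xs (≤-trans (n≤1+n _) lt))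

  count-pos⇒∃ : ∀ P xs → 0 < count P xs → ∃ λ x → x ∈ˡ xs × P x ≡ true
  count-pos⇒∃ P xs pos =
    map₂ (map₂ proj₁) (count-<⇒∃ P (λ _ → false) xs
      (subst (_< count P xs) (sym (count-none _ xs (λ _ _ → refl))) pos))

  count-point : ∀ P Q {a xs} → Unique xs → a ∈ˡ xs → (∀ x → x ≢ a → P x ≡ Q x) →
                count P xs + 𝟙[ Q a ] ≡ count Q xs + 𝟙[ P a ]
  count-point P Q {a} {.a ∷ xs} (a∉xs ∷ _) (here refl) P≗Q
    rewrite count-∷ P a xs | count-∷ Q a xs
          | count-cong P Q xs (λ x x∈ → P≗Q x (λ x≡a → All.lookup a∉xs x∈ (sym x≡a))) =
      xy∙z≈zy∙x 𝟙[ P a ] (count Q xs) 𝟙[ Q a ]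
  count-point P Q {a} {y ∷ xs} (y∉xs ∷ unique) (there a∈) P≗Q
    rewrite count-∷ P y xs | count-∷ Q y xs
          | +-assoc 𝟙[ P y ] (count P xs) 𝟙[ Q a ] | +-assoc 𝟙[ Q y ] (count Q xs) 𝟙[ P a ]
          | P≗Q y (All.lookup y∉xs a∈) =
      cong (𝟙[ Q y ] +_) (count-point P Q unique a∈ P≗Q)

  count-flip : ∀ P Q {a xs} → Unique xs → a ∈ˡ xs → (∀ x → x ≢ a → P x ≡ Q x) →
               P a ≡ false → Q a ≡ true → suc (count P xs) ≡ count Q xs
  count-flip P Q {a} {xs} unique a∈ P≗Q Pa Qa = begin
    suc (count P xs)        ≡⟨ +-comm 1 (count P xs) ⟩
    count P xs + 1          ≡⟨ cong (λ b → count P xs + 𝟙[ b ]) (sym Qa) ⟩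
    count P xs + 𝟙[ Q a ]   ≡⟨ count-point P Q unique a∈ P≗Q ⟩
    count Q xs + 𝟙[ P a ]   ≡⟨ cong (λ b → count Q xs + 𝟙[ b ]) Pa ⟩
    count Q xs + 0          ≡⟨ +-identityʳ _ ⟩
    count Q xs              ∎
    where open ≡-Reasoning

  count-filterᵇ : ∀ P Q xs → count P (filterᵇ Q xs) ≡ count (λ x → Q x ∧ P x) xs
  count-filterᵇ P Q [] = refl
  count-filterᵇ P Q (x ∷ xs) = begin
    count P (filterᵇ Q (x ∷ xs))                 ≡⟨ head ⟩
    𝟙[ Q x ∧ P x ] + count P (filterᵇ Q xs)
      ≡⟨ cong (𝟙[ Q x ∧ P x ] +_) (count-filterᵇ P Q xs) ⟩
    𝟙[ Q x ∧ P x ] + count (λ y → Q y ∧ P y) xs  ≡⟨ count-∷ (λ y → Q y ∧ P y) x xs ⟨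
    count (λ y → Q y ∧ P y) (x ∷ xs)             ∎
    where
    open ≡-Reasoning
    head : count P (filterᵇ Q (x ∷ xs)) ≡ 𝟙[ Q x ∧ P x ] + count P (filterᵇ Q xs)
    head with Q x
    ... | true  = count-∷ P x (filterᵇ Q xs)
    ... | false = refl

  All-filterᵇ⁻ : ∀ {R : A → Set} sel xs → All R (filterᵇ sel xs) →
                 ∀ {x} → x ∈ˡ xs → sel x ≡ true → R x
  All-filterᵇ⁻ sel xs all x∈ selx =
    All.lookup all (∈-filter⁺ (T? ∘ sel) x∈ (Equivalence.from T-≡ selx))

  All-filterᵇ⁺ : ∀ {R : A → Set} sel xs → (∀ {x} → x ∈ˡ xs → sel x ≡ true → R x) →
                 All R (filterᵇ sel xs)
  All-filterᵇ⁺ sel xs R-sel =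
    All.tabulate λ x∈ → let x∈xs , selx = ∈-filter⁻ (T? ∘ sel) x∈
                        in R-sel x∈xs (Equivalence.to T-≡ selx)

shift-bound : ∀ {a b c i j} → a + i ≡ b + j → b ≤ c + i → a ≤ c + j
shift-bound {a} {b} {c} {i} {j} a+i≡b+j b≤c+i = +-cancelʳ-≤ i a (c + j) (begin
  a + i        ≡⟨ a+i≡b+j ⟩
  b + j        ≤⟨ +-monoˡ-≤ j b≤c+i ⟩
  c + i + j    ≡⟨ +-assoc c i j ⟩
  c + (i + j)  ≡⟨ cong (c +_) (+-comm i j) ⟩
  c + (j + i)  ≡⟨ +-assoc c j i ⟨
  c + j + i    ∎)
  where open ≤-Reasoning

∣p∪q∣≤∣p∣+∣q∣ : ∀ {k} (p q : Subset k) → ∣ p ∪ q ∣ ≤ ∣ p ∣ + ∣ q ∣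
∣p∪q∣≤∣p∣+∣q∣ []            []            = z≤n
∣p∪q∣≤∣p∣+∣q∣ (outside ∷ p) (outside ∷ q) = ∣p∪q∣≤∣p∣+∣q∣ p q
∣p∪q∣≤∣p∣+∣q∣ (inside  ∷ p) (outside ∷ q) = s≤s (∣p∪q∣≤∣p∣+∣q∣ p q)
∣p∪q∣≤∣p∣+∣q∣ (outside ∷ p) (inside  ∷ q) =
  ≤-trans (s≤s (∣p∪q∣≤∣p∣+∣q∣ p q)) (≤-reflexive (sym (+-suc ∣ p ∣ ∣ q ∣)))
∣p∪q∣≤∣p∣+∣q∣ (inside  ∷ p) (inside  ∷ q) =
  s≤s (≤-trans (∣p∪q∣≤∣p∣+∣q∣ p q) (+-monoʳ-≤ ∣ p ∣ (n≤1+n ∣ q ∣)))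

module _ (G : CGraph) where

  Vertex : Set
  Vertex = Fin (n G)

  _≟ᴱ_ : DecidableEquality (Edge G)
  _≟ᴱ_ = ≡-dec _≟_ _≟_

  edges-unique : Unique (edges G)
  edges-unique = Unique.filter⁺ _ (Unique.cartesianProduct⁺ (Unique.allFin⁺ _) (Unique.allFin⁺ _))

  IsEndOf : Vertex → Edge G → Set
  IsEndOf v e = v ≡ proj₁ e ⊎ v ≡ proj₂ e

  ToEnds : (Edge G → Bool) → (Edge G → Vertex) → Set
  ToEnds sel g = ∀ {e} → e ∈ˡ edges G → sel e ≡ true → IsEndOf (g e) e

  indeg : (Edge G → Bool) → (Edge G → Vertex) → Vertex → ℕ
  indeg sel g v = count (λ e → sel e ∧ ⌊ g e ≟ v ⌋) (edges G)

  -- Capacity 0 outside C turns "C is a capacitated cover" into one inequality per vertex.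
  capWithin : Subset (n G) → Vertex → ℕ
  capWithin C v = if ⌊ v ∈? C ⌋ then cap G v else 0

  Cover : (Edge G → Bool) → Subset (n G) → (Edge G → Vertex) → Set
  Cover sel C g = ToEnds sel g × (∀ v → indeg sel g v ≤ capWithin C v)

  capWithin-∈ : ∀ {C v} → v ∈ C → capWithin C v ≡ cap G v
  capWithin-∈ {C} {v} v∈C with v ∈? C
  ... | yes _   = refl
  ... | no v∉C = contradiction v∈C v∉C

  capWithin-∉ : ∀ {C v} → v ∉ C → capWithin C v ≡ 0
  capWithin-∉ {C} {v} v∉C with v ∈? C
  ... | yes v∈C = contradiction v∈C v∉C
  ... | no _    = refl

  capWithin-mono : ∀ {C D} → C ⊆ D → ∀ v → capWithin C v ≤ capWithin D v
  capWithin-mono {C} C⊆D v with v ∈? C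
  ... | yes v∈C = ≤-reflexive (sym (capWithin-∈ (C⊆D v∈C)))
  ... | no _    = z≤n

  indeg-self : ∀ sel g {e} → e ∈ˡ edges G → sel e ≡ true → 0 < indeg sel g (g e)
  indeg-self sel g {e} e∈ sele =
    count-∈ (λ x → sel x ∧ ⌊ g x ≟ g e ⌋) e∈ (cong₂ _∧_ sele (≟-refl _≟_ (g e)))

  Cover-∈ : ∀ {sel C g e} → Cover sel C g → e ∈ˡ edges G → sel e ≡ true → g e ∈ C
  Cover-∈ {sel} {C} {g} {e} (_ , bounded) e∈ sele with g e ∈? C
  ... | yes ge∈C = ge∈C
  ... | no ge∉C  = contradiction
    (≤-trans (indeg-self sel g e∈ sele) (≤-trans (bounded (g e)) (≤-reflexive (capWithin-∉ ge∉C))))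
    (n≮n 0)

  Cover-mono : ∀ {sel sel' C g} → (∀ {e} → e ∈ˡ edges G → sel e ≡ true → sel' e ≡ true) →
               Cover sel' C g → Cover sel C g
  Cover-mono sel⇒sel' (ends , bounded) =
    (λ e∈ → ends e∈ ∘ sel⇒sel' e∈) ,
    (λ v → ≤-trans (count-mono _ _ (edges G) (λ e e∈ → ∧-monoˡ (sel⇒sel' e∈))) (bounded v))
    where
    ∧-monoˡ : ∀ {a b c} → (a ≡ true → b ≡ true) → a ∧ c ≡ true → b ∧ c ≡ true
    ∧-monoˡ {true} a⇒b a∧c rewrite a⇒b refl = a∧c

  load-edgesOf : ∀ sel g v → load G (edgesOf G sel) g v ≡ indeg sel g v
  load-edgesOf sel g v = count-filterᵇ (λ e → ⌊ g e ≟ v ⌋) sel (edges G)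

  IsCVC⇒Cover : ∀ {sel U C} → IsCVC G sel U C → ∃ (Cover sel C)
  IsCVC⇒Cover {sel} {C = C} (_ , g , ends∈C , capacity) = g , (λ e∈ → proj₁ ∘ ends∈C′ e∈) , bounded
    where
    ends∈C′ : ∀ {e} → e ∈ˡ edges G → sel e ≡ true → IsEndOf (g e) e × g e ∈ C
    ends∈C′ = All-filterᵇ⁻ sel (edges G) ends∈C
    unloaded : ∀ {v} → v ∉ C → ∀ e → e ∈ˡ edges G → (sel e ∧ ⌊ g e ≟ v ⌋) ≡ false
    unloaded v∉C e e∈ with sel e in sele
    ... | false = refl
    ... | true  = ≢⇒≟-false _≟_ (λ ge≡v → v∉C (subst (_∈ C) ge≡v (proj₂ (ends∈C′ e∈ sele))))
    bounded : ∀ v → indeg sel g v ≤ capWithin C v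
    bounded v with v ∈? C
    ... | yes v∈C = subst (_≤ cap G v) (load-edgesOf sel g v) (capacity v v∈C)
    ... | no v∉C  = ≤-reflexive (count-none _ (edges G) (unloaded v∉C))

  Cover⇒IsCVC : ∀ {sel U C g} → C ⊆ U → Cover sel C g → IsCVC G sel U C
  Cover⇒IsCVC {sel} {g = g} C⊆U cover@(ends , bounded) =
    C⊆U , g ,
    All-filterᵇ⁺ sel (edges G) (λ e∈ sele → ends e∈ sele , Cover-∈ cover e∈ sele) ,
    (λ v v∈C → subst₂ _≤_ (sym (load-edgesOf sel g v)) (capWithin-∈ v∈C) (bounded v))

  _[_↦_] : (Edge G → Vertex) → Edge G → Vertex → Edge G → Vertex
  (g [ e ↦ w ]) x = if ⌊ x ≟ᴱ e ⌋ then w else g x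

  ↦-hit : ∀ g e w → (g [ e ↦ w ]) e ≡ w
  ↦-hit g e w rewrite ≟-refl _≟ᴱ_ e = refl

  ↦-miss : ∀ g {e x} w → x ≢ e → (g [ e ↦ w ]) x ≡ g x
  ↦-miss g w x≢e rewrite ≢⇒≟-false _≟ᴱ_ x≢e = refl

  ToEnds-↦ : ∀ {sel g g' e} → (∀ {x} → x ∈ˡ edges G → x ≢ e → sel x ≡ true → IsEndOf (g x) x) →
             ToEnds sel g' → ToEnds sel (g [ e ↦ g' e ])
  ToEnds-↦ {e = e} g-ends g'-ends {x} x∈ selx with x ≟ᴱ e
  ... | yes refl = g'-ends x∈ selx
  ... | no x≢e   = g-ends x∈ x≢e selx

  indeg-↦ : ∀ {sel sel' e} g w v → e ∈ˡ edges G → sel' e ≡ true → (∀ x → x ≢ e → sel' x ≡ sel x) →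
            indeg sel' (g [ e ↦ w ]) v + 𝟙[ sel e ∧ ⌊ g e ≟ v ⌋ ] ≡ indeg sel g v + 𝟙[ ⌊ w ≟ v ⌋ ]
  indeg-↦ {sel} {sel'} {e} g w v e∈ sel'e same-off-e =
    trans (count-point (λ x → sel' x ∧ ⌊ (g [ e ↦ w ]) x ≟ v ⌋) (λ x → sel x ∧ ⌊ g x ≟ v ⌋)
                       edges-unique e∈ agree)
          (cong (λ b → indeg sel g v + 𝟙[ b ]) (cong₂ (λ s y → s ∧ ⌊ y ≟ v ⌋) sel'e (↦-hit g e w)))
    where
    agree : ∀ x → x ≢ e → (sel' x ∧ ⌊ (g [ e ↦ w ]) x ≟ v ⌋) ≡ (sel x ∧ ⌊ g x ≟ v ⌋)
    agree x x≢e = cong₂ (λ s y → s ∧ ⌊ y ≟ v ⌋) (same-off-e x x≢e) (↦-miss g w x≢e)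

  indeg-move : ∀ {sel e w} g w' v → e ∈ˡ edges G → sel e ≡ true → g e ≡ w →
               indeg sel (g [ e ↦ w' ]) v + 𝟙[ ⌊ w ≟ v ⌋ ] ≡ indeg sel g v + 𝟙[ ⌊ w' ≟ v ⌋ ]
  indeg-move {sel} {e} g w' v e∈ sele refl =
    trans (cong (λ s → indeg sel (g [ e ↦ w' ]) v + 𝟙[ s ∧ ⌊ g e ≟ v ⌋ ]) (sym sele))
          (indeg-↦ g w' v e∈ sele (λ _ _ → refl))

  module AddEdge {sel sel⁺ : Edge G → Bool} {e : Edge G} (e∈ : e ∈ˡ edges G)
                 (sel-e : sel e ≡ false) (sel⁺-e : sel⁺ e ≡ true)
                 (same-off-e : ∀ x → x ≢ e → sel⁺ x ≡ sel x)
                 {C C' : Subset (n G)} {f f' : Edge G → Vertex}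
                 (cover : Cover sel C f) (cover' : Cover sel⁺ C' f') where

    record Invariant (g : Edge G → Vertex) (w : Vertex) : Set where
      field
        ends    : ToEnds sel⁺ g
        bounded : ∀ v → indeg sel⁺ g v ≤ capWithin C v + 𝟙[ ⌊ w ≟ v ⌋ ]
        w∈C'    : w ∈ C'

    disagreement : (Edge G → Vertex) → ℕ
    disagreement g = count (λ x → sel⁺ x ∧ not ⌊ g x ≟ f' x ⌋) (edges G)

    start : Invariant (f [ e ↦ f' e ]) (f' e)
    start = record
      { ends    = ToEnds-↦ (λ x∈ x≢e sel⁺x → proj₁ cover x∈ (trans (sym (same-off-e _ x≢e)) sel⁺x))
                           (proj₁ cover')
      ; bounded = λ v → shift-bound (indeg-↦ f (f' e) v e∈ sel⁺-e same-off-e)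
                                    (≤-trans (proj₂ cover v) (m≤m+n _ _))
      ; w∈C'    = Cover-∈ cover' e∈ sel⁺-e
      }

    movable : ∀ {g w} → Invariant g w → cap G w < indeg sel⁺ g w →
              ∃ λ x → x ∈ˡ edges G × sel⁺ x ≡ true × g x ≡ w × f' x ≢ w
    movable {g} {w} inv overfull
      with count-<⇒∃ (λ x → sel⁺ x ∧ ⌊ g x ≟ w ⌋) (λ x → sel⁺ x ∧ ⌊ f' x ≟ w ⌋) (edges G)
             (≤-<-trans (subst (indeg sel⁺ f' w ≤_) (capWithin-∈ (Invariant.w∈C' inv))
                                (proj₂ cover' w))
                        overfull)
    ... | x , x∈ , to-w , f'-elsewhere with sel⁺ x in sel⁺x
    ...   | true = x , x∈ , sel⁺x , ≟-true⇒≡ _≟_ to-w , ≟-false⇒≢ _≟_ f'-elsewhere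

    redirect : ∀ {g w x} → Invariant g w → x ∈ˡ edges G → sel⁺ x ≡ true → g x ≡ w → f' x ≢ w →
               Invariant (g [ x ↦ f' x ]) (f' x) × disagreement (g [ x ↦ f' x ]) < disagreement g
    redirect {g} {w} {x} inv x∈ sel⁺x gx≡w f'x≢w = inv' , fewer
      where
      open Invariant inv
      inv' : Invariant (g [ x ↦ f' x ]) (f' x)
      inv' = record
        { ends    = ToEnds-↦ (λ y∈ _ → ends y∈) (proj₁ cover')
        ; bounded = λ v → shift-bound (indeg-move g (f' x) v x∈ sel⁺x gx≡w) (bounded v)
        ; w∈C'    = Cover-∈ cover' x∈ sel⁺x
        }
      agreed : (sel⁺ x ∧ not ⌊ (g [ x ↦ f' x ]) x ≟ f' x ⌋) ≡ false
      agreed rewrite sel⁺x | ↦-hit g x (f' x) | ≟-refl _≟_ (f' x) = refl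
      disagreed : (sel⁺ x ∧ not ⌊ g x ≟ f' x ⌋) ≡ true
      disagreed rewrite sel⁺x | gx≡w | ≢⇒≟-false _≟_ (f'x≢w ∘ sym) = refl
      fewer : disagreement (g [ x ↦ f' x ]) < disagreement g
      fewer = ≤-reflexive (count-flip _ _ edges-unique x∈
                (λ y y≢x → cong (λ u → sel⁺ y ∧ not ⌊ u ≟ f' y ⌋) (↦-miss g (f' x) y≢x))
                agreed disagreed)

    close : ∀ {g w} → Invariant g w → indeg sel⁺ g w ≤ cap G w → Cover sel⁺ (C ∪ ⁅ w ⁆) g
    close {g} {w} inv fits = ends , bounded′
      where
      open Invariant inv
      bounded′ : ∀ v → indeg sel⁺ g v ≤ capWithin (C ∪ ⁅ w ⁆) v
      bounded′ v with w ≟ v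
      ... | yes refl = ≤-trans fits (≤-reflexive (sym (capWithin-∈ (x∈p∪q⁺ (inj₂ (x∈⁅x⁆ w))))))
      ... | no w≢v   = ≤-trans (bounded v)
        (≤-trans (≤-reflexive (trans (cong (λ b → _ + 𝟙[ b ]) (≢⇒≟-false _≟_ w≢v)) (+-identityʳ _)))
                 (capWithin-mono (p⊆p∪q ⁅ w ⁆) v))

    augment : ∀ {g w} → Invariant g w → Acc _<_ (disagreement g) →
              ∃ λ w → w ∈ C' × ∃ (Cover sel⁺ (C ∪ ⁅ w ⁆))
    augment {g} {w} inv (acc smaller) with indeg sel⁺ g w ≤? cap G w
    ... | yes fits    = w , Invariant.w∈C' inv , g , close inv fits
    ... | no overfull with movable inv (≰⇒> overfull)
    ...   | x , x∈ , sel⁺x , gx≡w , f'x≢w with redirect inv x∈ sel⁺x gx≡w f'x≢w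
    ...     | inv' , fewer = augment inv' (smaller fewer)

    add-edge : ∀ {U} → C ⊆ U → C' ⊆ U → ∃ λ D → D ⊆ U × ∣ D ∣ ≤ suc ∣ C ∣ × ∃ (Cover sel⁺ D)
    add-edge {U} C⊆U C'⊆U with augment start (<-wellFounded _)
    ... | w , w∈C' , cover⁺ = C ∪ ⁅ w ⁆ , ⊆U , size , cover⁺
      where
      ⊆U : C ∪ ⁅ w ⁆ ⊆ U
      ⊆U v∈ with x∈p∪q⁻ C ⁅ w ⁆ v∈
      ... | inj₁ v∈C = C⊆U v∈C
      ... | inj₂ v∈w rewrite x∈⁅y⁆⇒x≡y w v∈w = C'⊆U w∈C'
      size : ∣ C ∪ ⁅ w ⁆ ∣ ≤ suc ∣ C ∣
      size = ≤-trans (∣p∪q∣≤∣p∣+∣q∣ C ⁅ w ⁆)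
                     (≤-reflexive (trans (cong (∣ C ∣ +_) (∣⁅x⁆∣≡1 w)) (+-comm ∣ C ∣ 1)))

  _∖_ : (Edge G → Bool) → (Edge G → Bool) → Edge G → Bool
  (sel' ∖ sel) e = sel' e ∧ not (sel e)

  module Extend {U : Subset (n G)} {sel' : Edge G → Bool} {C' : Subset (n G)} {f' : Edge G → Vertex}
                (C'⊆U : C' ⊆ U) (cover' : Cover sel' C' f') where

    extend : ∀ N {sel C f} → count (sel' ∖ sel) (edges G) ≡ N →
             (∀ {e} → sel e ≡ true → sel' e ≡ true) → C ⊆ U → Cover sel C f → ∃ λ D → D ⊆ U × ∣ D ∣ ≤ ∣ C ∣ + N × ∃ (Cover sel' D)
    extend zero {sel} {C} {f} none _ C⊆U cover =
      C , C⊆U , m≤m+n ∣ C ∣ 0 , f , Cover-mono recovered cover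
      where
      recovered : ∀ {e} → e ∈ˡ edges G → sel' e ≡ true → sel e ≡ true
      recovered {e} e∈ sel'e with sel e in sele
      ... | true  = refl
      ... | false = contradiction
        (subst (0 <_) none (count-∈ (sel' ∖ sel) e∈ (cong₂ (λ a b → a ∧ not b) sel'e sele))) (n≮n 0)
    extend (suc N) {sel} {C} {f} some sel⊆sel' C⊆U cover
      with count-pos⇒∃ (sel' ∖ sel) (edges G) (subst (0 <_) (sym some) (s≤s z≤n))
    ... | e , e∈ , missing-e = result
      where
      sel⁺ : Edge G → Bool
      sel⁺ x = sel x ∨ ⌊ x ≟ᴱ e ⌋

      missing : ∀ {a b} → a ∧ not b ≡ true → a ≡ true × b ≡ false
      missing {true} {false} _ = refl , refl

      sel'-e : sel' e ≡ true
      sel'-e = proj₁ (missing missing-e)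
      sel-e : sel e ≡ false
      sel-e = proj₂ (missing missing-e)
      sel⁺-e : sel⁺ e ≡ true
      sel⁺-e = trans (cong (sel e ∨_) (≟-refl _≟ᴱ_ e)) (∨-zeroʳ (sel e))
      same-off-e : ∀ x → x ≢ e → sel⁺ x ≡ sel x
      same-off-e x x≢e = trans (cong (sel x ∨_) (≢⇒≟-false _≟ᴱ_ x≢e)) (∨-identityʳ (sel x))

      sel⁺⊆sel' : ∀ {x} → sel⁺ x ≡ true → sel' x ≡ true
      sel⁺⊆sel' {x} sel⁺x with x ≟ᴱ e
      ... | yes refl = sel'-e
      ... | no _     = sel⊆sel' (trans (sym (∨-identityʳ (sel x))) sel⁺x)

      remaining : count (sel' ∖ sel⁺) (edges G) ≡ N
      remaining = suc-injective (trans
        (count-flip (sel' ∖ sel⁺) (sel' ∖ sel) edges-unique e∈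
                    (λ x x≢e → cong (λ b → sel' x ∧ not b) (same-off-e x x≢e))
                    (cong₂ (λ a b → a ∧ not b) sel'-e sel⁺-e) missing-e)
        some)

      result : ∃ λ D → D ⊆ U × ∣ D ∣ ≤ ∣ C ∣ + suc N × ∃ (Cover sel' D)
      result with AddEdge.add-edge e∈ sel-e sel⁺-e same-off-e
                    cover (Cover-mono (λ _ → sel⁺⊆sel') cover') C⊆U C'⊆U
      ... | D₁ , D₁⊆U , size₁ , _ , cover₁ with extend N remaining sel⁺⊆sel' D₁⊆U cover₁
      ...   | D , D⊆U , size , cover″ =
        D , D⊆U ,
        ≤-trans size (≤-trans (+-monoˡ-≤ N size₁) (≤-reflexive (sym (+-suc ∣ C ∣ N)))) ,
        cover″

  IsCVC-mono : ∀ {sel sel' U C} → (∀ {e} → sel e ≡ true → sel' e ≡ true) →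
               IsCVC G sel' U C → IsCVC G sel U C
  IsCVC-mono sel⊆sel' cvc with IsCVC⇒Cover cvc
  ... | _ , cover = Cover⇒IsCVC (proj₁ cvc) (Cover-mono (λ _ → sel⊆sel') cover)

  IsCVC-extend : ∀ {sel sel' U C C'} → (∀ {e} → sel e ≡ true → sel' e ≡ true) →
                 IsCVC G sel' U C' → IsCVC G sel U C →
                 ∃ λ D → IsCVC G sel' U D × ∣ D ∣ ≤ ∣ C ∣ + count (sel' ∖ sel) (edges G)
  IsCVC-extend sel⊆sel' cvc' cvc with IsCVC⇒Cover cvc' | IsCVC⇒Cover cvc
  ... | _ , cover' | _ , cover
    with Extend.extend (proj₁ cvc') cover' _ refl sel⊆sel' (proj₁ cvc) cover
  ...   | D , D⊆U , size , _ , coverD = D , Cover⇒IsCVC D⊆U coverD , size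

InRangeβ-mono : ∀ {j k b} → j ≤ k → InRangeβ j b → InRangeβ k b
InRangeβ-mono j≤k (inj₁ (i , i≤j , b≡i)) = inj₁ (i , ≤-trans i≤j j≤k , b≡i)
InRangeβ-mono j≤k (inj₂ b≡∞)             = inj₂ b≡∞

InRangeβ-fin : ∀ {k x a} → a ≤ x → x ≤ a + k → InRangeβ k (fin x −∞ fin a)
InRangeβ-fin {x = x} {a} a≤x x≤a+k =
  inj₁ (x ∸ a , m≤n+o⇒m∸n≤o x a x≤a+k , cong int (trans (ℤ.m-n≡m⊖n x a) (ℤ.⊖-≥ a≤x)))

cvc-gap : ∀ G {sel sel' U} x a → (∀ {e} → sel e ≡ true → sel' e ≡ true) →
          CvcIs G sel' U x → CvcIs G sel U a → InRangeβ (count (_∖_ G sel' sel) (edges G)) (x −∞ a)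
cvc-gap G ∞       _       _        _                         _ = inj₂ refl
cvc-gap G (fin _) ∞       sel⊆sel' ((C' , cvc' , _) , _)   none =
  contradiction (IsCVC-mono G sel⊆sel' cvc') (none C')
cvc-gap G (fin _) (fin _) sel⊆sel' ((C' , cvc' , refl) , min') ((C , cvc , refl) , min)
  with IsCVC-extend G sel⊆sel' cvc' cvc
... | D , cvcD , size =
  InRangeβ-fin (min C' (IsCVC-mono G sel⊆sel' cvc')) (≤-trans (min' D cvcD) size)

isAnc-root : ∀ {G} (D : RTCD G) d u → depth D u ≡ d → isAnc D d (root D) u ≡ true
isAnc-root D zero u depth≡0 with root D ≟ u
... | yes _  = refl
... | no r≢u = contradiction (trans (sym (depth-par D u (r≢u ∘ sym))) depth≡0) 1+n≢0
isAnc-root D (suc d) u depth≡d with root D ≟ u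
... | yes _  = refl
... | no r≢u =
  isAnc-root D d (par D u) (suc-injective (trans (sym (depth-par D u (r≢u ∘ sym))) depth≡d))

inY-root : ∀ {G} (D : RTCD G) v → inY D (root D) v ≡ true
inY-root D v = isAnc-root D _ (bag D v) refl

inK-root : ∀ {G} (D : RTCD G) e → inK D (root D) e ≡ false
inK-root D (u , v) rewrite inY-root D u | inY-root D v = refl

count-inK≤width : ∀ {G} (D : RTCD G) {k} → (∀ t → t ≢ root D → cutSize D t ≤ k) →
                  ∀ t → count (inK D t) (edges G) ≤ k
count-inK≤width {G} D cut≤k t with t ≟ root D
... | no t≢r  = cut≤k t t≢r
... | yes t≡r rewrite t≡r = subst (_≤ _) (sym (count-none _ (edges G) (λ e _ → inK-root D e))) z≤n

lemma4p4 : (G : CGraph) (D : RTCD G) (k : ℕ) →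
    Nice D → WidthAtMost D k →
    (t : Fin (m D)) →
    (E' : Edge G → Bool) → (∀ e → E' e ≡ true → inK D t e ≡ true) →
    ∀ x a →
    CvcIs G (λ e → inE D t e ∨ E' e) (Y D t) x →
    CvcIs G (inE D t) (Y D t) a →
    InRangeβ k (x −∞ a)
lemma4p4 G D k _ (cut≤k , _) t E' E'⊆K x a cvc-H cvc-Yt =
  InRangeβ-mono (≤-trans (count-mono _ _ (edges G) added⊆K) (count-inK≤width D cut≤k t))
                (cvc-gap G x a (λ {e} old → cong (_∨ E' e) old) cvc-H cvc-Yt)
  where
  added⊆K : ∀ e → e ∈ˡ edges G → (inE D t e ∨ E' e) ∧ not (inE D t e) ≡ true → inK D t e ≡ true
  added⊆K e _ added = E'⊆K e (new-edge (inE D t e) (E' e) added)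
    where
    new-edge : ∀ a b → (a ∨ b) ∧ not a ≡ true → b ≡ true
    new-edge false true _ = refl
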